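{- Let $\mathcal{G}$ be a nonempty signed colored graph of type $(n,n)$ satisfying Axiom 1 and admitting a morphism $\phi\colon\mathcal{G}\to\mathcal{G}_\lambda$ for some $\lambda\vdash n$. Then $\mathcal{G}$ is isomorphic to the $(n,n)$-restriction of some signed colored graph $\mathcal{H}=(V',\sigma',E'_2\cup\dots\cup E'_{n-1})$ with $\sigma'\colon V'\to\{\pm1\}^{N-1}$ for some $N\ge n$, satisfying: (1) $\mathcal{H}$ obeys Axiom 1; (2) $V'\subseteq S_N$; (3) $\sigma'(v')$ is the signature (given by inverse descents) of the permutation $v'$; (4) for all $1<i<n$ and all $v'\in V'$ admitting an $i$-edge, $E'_i(v')$ is Knuth equivalent to $d_i(v')$.
   Context: Tableaux are in French notation. $P(w)$ is the Robinson–Schensted insertion tableau of a permutation $w$; permutations are Knuth equivalent if they have the same insertion tableau. For $w\in S_N$, $\sigma(w)\in\{\pm1\}^{N-1}$ with $\sigma(w)_i=+1$ if $i$ appears before $i+1$ in $w$, $-1$ otherwise; a tableau's signature is that of its row reading word (rows left to right, starting with the top row). For $1<i<N$, $d_i$ fixes $w$ if the value $i$ lies positionally between $i-1$ and $i+1$; otherwise it interchanges $i$ with whichever of $i-1,i+1$ is not in the middle of the three positions; it acts on tableaux via row reading words. For $\lambda\vdash n$, $\mathcal G_\lambda$ has vertex set $\mathrm{SYT}(\lambda)$, tableau signatures, and $i$-edges $\{T,d_i(T)\}$ with $d_i(T)\ne T$, $1<i<n$. A signed colored graph $(V,\sigma,E_{m+1}\cup\dots\cup E_{n-1})$ has a finite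 vertex set $V$, sets $E_i$ ($m<i<n$) of unordered pairs of distinct vertices, and $\sigma\colon V\to\{\pm1\}^{N-1}$ with $N\ge n$; it has type $(n,N)$ if $m=1$. Its $(m',M)$-restriction discards $E_i$ for $i\ge m'$ and truncates signatures to their first $M-1$ coordinates. A morphism sends $i$-edges to $i$-edges and preserves signatures; an isomorphism is a morphism with an inverse morphism. A vertex $v$ admits an $i$-neighbor if $\sigma(v)_{i-1}=-\sigma(v)_i$. Axiom 1: each $E_i$ is a complete matching on the vertices admitting an $i$-neighbor; $E_i(v)$ then denotes the vertex matched with $v$. -}

module Defs where

open import Data.Nat using (ℕ; zero; suc; _+_; _∸_; _<_; _≤_; _≥_; _<ᵇ_; _≡ᵇ_; z≤n; s≤s)
open import Data.Nat.Properties using (∸-monoˡ-≤; ≤-refl)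
open import Data.Bool using (Bool; true; false; if_then_else_; _∨_; _∧_)
open import Data.List using (List; []; _∷_; [_]; map; upTo; concat; reverse; foldl; length)
open import Data.Nat.ListAction using (sum)
open import Data.List.Membership.Propositional using (_∈_)
open import Data.List.Relation.Unary.All using (All)
open import Data.List.Relation.Unary.Linked using (Linked)
open import Data.List.Relation.Binary.Permutation.Propositional using (_↭_)
open import Data.Vec using (Vec; tabulate) renaming ([] to []ᵛ; _∷_ to _∷ᵛ_)
open import Data.Fin using (Fin; toℕ)
open import Data.Maybe using (Maybe; just; nothing)
open import Data.Product using (Σ; _×_; _,_; proj₁; proj₂)
open import Data.Sum using (_⊎_; inj₁; inj₂)
open import Data.Empty using (⊥)
open import Relation.Nullary using (¬_)
open import Relation.Binary.PropositionalEquality using (_≡_; _≢_; refl)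

data Sign : Set where
  plus minus : Sign

neg : Sign → Sign
neg plus  = minus
neg minus = plus

-- 1-indexed coordinate of a signature (default value outside the range
-- 1..k; it is only ever used inside the range).
at : ∀ {k} → Vec Sign k → ℕ → Sign
at []ᵛ       _             = plus
at (x ∷ᵛ xs) zero          = plus
at (x ∷ᵛ xs) (suc zero)    = x
at (x ∷ᵛ xs) (suc (suc i)) = at xs (suc i)

truncVec : ∀ {A : Set} {m k} → m ≤ k → Vec A k → Vec A m
truncVec z≤n       _         = []ᵛ
truncVec (s≤s p) (x ∷ᵛ xs) = x ∷ᵛ truncVec p xs

-- Words / permutations (one-line notation, values 1..N)

Word : Set
Word = List ℕ

IsPerm : ℕ → Word → Set
IsPerm N w = w ↭ map suc (upTo N)

pos : ℕ → Word → ℕ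
pos x []       = 0
pos x (y ∷ ys) = if x ≡ᵇ y then 0 else suc (pos x ys)

-- σ(w) ∈ {±1}^{N-1}: coordinate i (1 ≤ i ≤ N-1) is + iff i appears before i+1
sigW : (N : ℕ) → Word → Vec Sign (N ∸ 1)
sigW N w = tabulate λ k →
  if pos (suc (toℕ k)) w <ᵇ pos (suc (suc (toℕ k))) w then plus else minus

swapV : ℕ → ℕ → Word → Word
swapV a b = map λ x → if x ≡ᵇ a then b else (if x ≡ᵇ b then a else x)

betweenᵇ : ℕ → ℕ → ℕ → Bool
betweenᵇ m a b = ((a <ᵇ m) ∧ (m <ᵇ b)) ∨ ((b <ᵇ m) ∧ (m <ᵇ a))

dW : ℕ → Word → Word
dW i w =
  if betweenᵇ (pos i w) (pos (i ∸ 1) w) (pos (suc i) w) then w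
  else (if betweenᵇ (pos (i ∸ 1) w) (pos i w) (pos (suc i) w)
        then swapV i (suc i) w
        else swapV i (i ∸ 1) w)

-- Tableaux (French notation): list of rows, bottom (longest) row first.

Tableau : Set
Tableau = List (List ℕ)

insRow : ℕ → List ℕ → Maybe ℕ × List ℕ
insRow x []       = nothing , [ x ]
insRow x (y ∷ ys) with x <ᵇ y
... | true  = just y , (x ∷ ys)
... | false with insRow x ys
...   | b , ys' = b , (y ∷ ys')

insT : ℕ → Tableau → Tableau
insT x []       = [ x ] ∷ []
insT x (r ∷ rs) with insRow x r
... | nothing , r' = r' ∷ rs
... | just y  , r' = r' ∷ insT y rs

P : Word → Tableau
P w = foldl (λ T x → insT x T) [] w

KnuthEquiv : Word → Word → Set
KnuthEquiv w w' = P w ≡ P w'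

reading : Tableau → Word
reading T = concat (reverse T)

Partition : ℕ → List ℕ → Set
Partition n λ′ = Linked _≥_ λ′ × All (λ k → 0 < k) λ′ × sum λ′ ≡ n

data Below : List ℕ → List ℕ → Set where
  []  : ∀ {xs} → Below xs []
  _∷_ : ∀ {x y xs ys} → x < y → Below xs ys → Below (x ∷ xs) (y ∷ ys)

SYT : ℕ → List ℕ → Tableau → Set
SYT n λ′ T =
  map length T ≡ λ′ ×
  All (Linked _<_) T ×
  Linked Below T ×
  concat T ↭ map suc (upTo n)

record SCG (n N : ℕ) : Set₁ where
  field
    V     : Set
    σ     : V → Vec Sign (N ∸ 1)
    E     : ℕ → V → V → Set
    n≤N   : n ≤ N
    E-col : ∀ {i u v} → E i u v → 1 < i × i < n
    E-sym : ∀ {i u v} → E i u v → E i v u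
    E-irr : ∀ {i v} → ¬ E i v v

open SCG public

Finite : ∀ {n N} → SCG n N → Set
Finite G = Σ (List (V G)) λ l → ∀ v → v ∈ l

Admits : ∀ {n N} (G : SCG n N) → ℕ → V G → Set
Admits G i v = at (σ G v) (i ∸ 1) ≡ neg (at (σ G v) i)

Axiom1 : ∀ {n N} → SCG n N → Set
Axiom1 {n} G = ∀ i → 1 < i → i < n → ∀ v →
  (Admits G i v → Σ (V G) λ u → E G i v u × (∀ w → E G i v w → w ≡ u)) ×
  (¬ Admits G i v → ∀ u → ¬ E G i v u)

record Morphism {n N} (G H : SCG n N) : Set where
  field
    map-V : V G → V H
    map-E : ∀ {i u v} → E G i u v → E H i (map-V u) (map-V v)
    map-σ : ∀ v → σ H (map-V v) ≡ σ G v

record Iso {n N} (G H : SCG n N) : Set where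
  field
    to      : Morphism G H
    from    : Morphism H G
    from∘to : ∀ v → Morphism.map-V from (Morphism.map-V to v) ≡ v
    to∘from : ∀ v → Morphism.map-V to (Morphism.map-V from v) ≡ v

-- (n,n)-restriction of a graph of type (n,N): no colors to discard,
-- signatures truncated to their first n-1 coordinates
restrict : ∀ {n N} → SCG n N → SCG n n
restrict {n} {N} H = record
  { V = V H
  ; σ = λ v → truncVec (∸-monoˡ-≤ 1 (n≤N H)) (σ H v)
  ; E = E H
  ; n≤N = ≤-refl
  ; E-col = E-col H
  ; E-sym = E-sym H
  ; E-irr = E-irr H
  }

DStep : ℕ → Tableau → Tableau → Set
DStep i T T' = reading T' ≡ dW i (reading T) × T ≢ T'

Gλ : (n : ℕ) → List ℕ → SCG n n
Gλ n λ′ = record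
  { V = Σ Tableau (SYT n λ′)
  ; σ = λ T → sigW n (reading (proj₁ T))
  ; E = λ i S T → (1 < i × i < n) × (DStep i (proj₁ S) (proj₁ T) ⊎ DStep i (proj₁ T) (proj₁ S))
  ; n≤N = ≤-refl
  ; E-col = proj₁
  ; E-sym = λ { (c , inj₁ s) → c , inj₂ s ; (c , inj₂ s) → c , inj₁ s }
  ; E-irr = λ { (c , inj₁ (_ , ne)) → ne refl ; (c , inj₂ (_ , ne)) → ne refl }
  }

-- Enumerate the K vertices of G and send the c-th vertex v to the permutation t_c · r(v) of
-- {1, …, n + 3K}, where r(v) is the reading word of the tableau φ(v) and the tag t_c consists of
-- K blocks of three consecutive letters above n, the first c blocks ordered y z x and the
-- others y x z (x < y < z).  Distinct vertices get distinct tags, but y x z ∼ y z x is a Knuth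
-- relation after any tableau with smaller entries, so all tags have the same insertion tableau.
-- The tag letters exceed n, so prefixing a tag changes neither d_i for i < n nor the first n − 1
-- signature coordinates.  If u is the i-neighbour of v then r(u) = d_i(r(v)), φ being a morphism
-- and d_i an involution, and since P is a left fold,
-- P(t_u r(u)) = P(t_v d_i(r(v))) = P(d_i(t_v r(v))).

module Submission where

open import Defs
open import Data.Nat using (ℕ; zero; suc; _+_; _*_; _∸_; _≤_; _<_; _<ᵇ_; _≡ᵇ_; z≤n; s≤s)
open import Data.Nat.Properties
open import Data.Bool using (Bool; true; false; T; if_then_else_; _∧_)
open import Data.Bool.Properties using (∨-comm; T-∨; T-∧)
open import Data.List using (List; []; _∷_; _++_; [_]; map; length; foldl; concat; upTo; applyUpTo; lookup)
open import Data.List.Properties using (++-assoc; map-++; map-id-local; map-upTo; foldl-++; ∷-injectiveˡ; ∷-injectiveʳ)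
open import Data.List.Relation.Unary.All as All using (All; []; _∷_)
import Data.List.Relation.Unary.All.Properties as All
open import Data.List.Relation.Unary.Any using (index)
open import Data.List.Relation.Unary.Any.Properties using (lookup-index)
open import Data.List.Membership.Propositional using (_∈_)
open import Data.List.Relation.Binary.Permutation.Propositional using (_↭_; refl; prep; swap; trans; module PermutationReasoning)
open import Data.List.Relation.Binary.Permutation.Propositional.Properties using (++⁺ˡ; ++⁺; shifts; ++-comm; ↭-reverse)
open import Data.Maybe using (just; nothing)
import Data.Maybe.Relation.Unary.All as Maybe
open import Data.Vec using (Vec; tabulate) renaming ([] to []ᵛ; _∷_ to _∷ᵛ_)
open import Data.Fin using (toℕ)
open import Data.Fin.Properties using (toℕ<n; toℕ-injective)
open import Data.Product as Product using (Σ; _×_; _,_; proj₁; proj₂)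
open import Data.Sum as Sum using (_⊎_; inj₁; inj₂)
open import Data.Empty using (⊥-elim)
open import Data.Unit using (tt)
open import Function using (_∘_; Equivalence)
open import Relation.Nullary using (¬_; contradiction)
open import Relation.Binary.PropositionalEquality
  using (_≡_; _≢_; refl; sym; cong; cong₂; subst; module ≡-Reasoning)
  renaming (trans to ≡-trans)

<ᵇ-true : ∀ {m n} → m < n → (m <ᵇ n) ≡ true
<ᵇ-true {m} {n} m<n with m <ᵇ n | <⇒<ᵇ m<n
... | true | _ = refl

<ᵇ-false : ∀ {m n} → n ≤ m → (m <ᵇ n) ≡ false
<ᵇ-false {m} {n} n≤m with m <ᵇ n | <ᵇ⇒< m n
... | false | _   = refl
... | true  | m<n = contradiction (m<n tt) (≤⇒≯ n≤m)

+-cancelˡ-<ᵇ : ∀ l m n → (l + m <ᵇ l + n) ≡ (m <ᵇ n)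
+-cancelˡ-<ᵇ zero    m n = refl
+-cancelˡ-<ᵇ (suc l) m n = +-cancelˡ-<ᵇ l m n

≡ᵇ-refl : ∀ n → (n ≡ᵇ n) ≡ true
≡ᵇ-refl zero    = refl
≡ᵇ-refl (suc n) = ≡ᵇ-refl n

≢⇒≡ᵇ-false : ∀ {m n} → m ≢ n → (m ≡ᵇ n) ≡ false
≢⇒≡ᵇ-false {m} {n} m≢n with m ≡ᵇ n | ≡ᵇ⇒≡ m n
... | false | _   = refl
... | true  | m≡n = contradiction (m≡n tt) m≢n

≡ᵇ-cong : ∀ {m n m′ n′} → (m ≡ n → m′ ≡ n′) → (m′ ≡ n′ → m ≡ n) → (m ≡ᵇ n) ≡ (m′ ≡ᵇ n′)
≡ᵇ-cong {m} {n} {m′} {n′} to from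
  with m ≡ᵇ n | ≡ᵇ⇒≡ m n | ≡⇒≡ᵇ m n | m′ ≡ᵇ n′ | ≡ᵇ⇒≡ m′ n′ | ≡⇒≡ᵇ m′ n′
... | true  | _   | _ | true  | _    | _ = refl
... | false | _   | _ | false | _    | _ = refl
... | true  | m≡n | _ | false | _    | p = ⊥-elim (p (to (m≡n tt)))
... | false | _   | p | true  | m′≡n′ | _ = ⊥-elim (p (from (m′≡n′ tt)))

interval : ℕ → ℕ → List ℕ
interval a zero    = []
interval a (suc k) = a ∷ interval (suc a) k

interval-+ : ∀ a k m → interval a (k + m) ≡ interval a k ++ interval (a + k) m
interval-+ a zero    m rewrite +-identityʳ a = refl
interval-+ a (suc k) m rewrite +-suc a k = cong (a ∷_) (interval-+ (suc a) k m)

applyUpTo≡interval : ∀ {f : ℕ → ℕ} a k → (∀ i → f i ≡ a + i) → applyUpTo f k ≡ interval a k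
applyUpTo≡interval a zero    _   = refl
applyUpTo≡interval a (suc k) f≗ =
  cong₂ _∷_ (≡-trans (f≗ 0) (+-identityʳ a)) (applyUpTo≡interval (suc a) k (λ i → ≡-trans (f≗ (suc i)) (+-suc a i)))

upTo≡interval : ∀ n → map suc (upTo n) ≡ interval 1 n
upTo≡interval n = ≡-trans (map-upTo suc n) (applyUpTo≡interval 1 n (λ _ → refl))

++-injectiveˡ : ∀ {A : Set} {xs ys zs ws : List A} → length xs ≡ length ys → xs ++ zs ≡ ys ++ ws → xs ≡ ys
++-injectiveˡ {xs = []}     {[]}     _ _ = refl
++-injectiveˡ {xs = x ∷ xs} {y ∷ ys} l e =
  cong₂ _∷_ (∷-injectiveˡ e) (++-injectiveˡ (suc-injective l) (∷-injectiveʳ e))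

concat⁺ : ∀ {A : Set} {xss yss : List (List A)} → xss ↭ yss → concat xss ↭ concat yss
concat⁺ refl           = refl
concat⁺ (prep xs p)    = ++⁺ˡ xs (concat⁺ p)
concat⁺ (swap xs ys p) = trans (shifts xs ys) (++⁺ˡ ys (++⁺ˡ xs (concat⁺ p)))
concat⁺ (trans p q)    = trans (concat⁺ p) (concat⁺ q)

transpose : ℕ → ℕ → ℕ → ℕ
transpose a b x = if x ≡ᵇ a then b else (if x ≡ᵇ b then a else x)

transpose-involutive : ∀ a b x → transpose a b (transpose a b x) ≡ x
transpose-involutive a b x with x ≡ᵇ a in x≟a | ≡ᵇ⇒≡ x a
... | true | x≡a with b ≡ᵇ a | ≡ᵇ⇒≡ b a
...   | true  | b≡a = ≡-trans (b≡a tt) (sym (x≡a tt))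
...   | false | _ rewrite ≡ᵇ-refl b = sym (x≡a tt)
transpose-involutive a b x | false | _ with x ≡ᵇ b in x≟b | ≡ᵇ⇒≡ x b
... | true  | x≡b rewrite ≡ᵇ-refl a = sym (x≡b tt)
... | false | _ rewrite x≟a | x≟b = refl

transpose-left : ∀ a b → transpose a b a ≡ b
transpose-left a b rewrite ≡ᵇ-refl a = refl

transpose-right : ∀ {a b} → a ≢ b → transpose a b b ≡ a
transpose-right {a} {b} a≢b rewrite ≢⇒≡ᵇ-false (a≢b ∘ sym) | ≡ᵇ-refl b = refl

transpose-other : ∀ {a b c} → c ≢ a → c ≢ b → transpose a b c ≡ c
transpose-other c≢a c≢b rewrite ≢⇒≡ᵇ-false c≢a | ≢⇒≡ᵇ-false c≢b = refl

pos-map-involutive : ∀ {g : ℕ → ℕ} → (∀ y → g (g y) ≡ y) → ∀ c w → pos c (map g w) ≡ pos (g c) w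
pos-map-involutive g² c []      = refl
pos-map-involutive {g} g² c (y ∷ w) =
  cong₂ (λ found p → if found then 0 else suc p)
    (≡ᵇ-cong (λ c≡gy → ≡-trans (cong g c≡gy) (g² y)) (λ gc≡y → ≡-trans (sym (g² c)) (cong g gc≡y)))
    (pos-map-involutive g² c w)

pos-swapV : ∀ a b c w → pos c (swapV a b w) ≡ pos (transpose a b c) w
pos-swapV a b = pos-map-involutive (transpose-involutive a b)

pos-swapV-left : ∀ a b w → pos a (swapV a b w) ≡ pos b w
pos-swapV-left a b w = ≡-trans (pos-swapV a b a w) (cong (λ c → pos c w) (transpose-left a b))

pos-swapV-right : ∀ {a b} → a ≢ b → ∀ w → pos b (swapV a b w) ≡ pos a w
pos-swapV-right {a} {b} a≢b w = ≡-trans (pos-swapV a b b w) (cong (λ c → pos c w) (transpose-right a≢b))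

pos-swapV-other : ∀ {a b c} → c ≢ a → c ≢ b → ∀ w → pos c (swapV a b w) ≡ pos c w
pos-swapV-other {a} {b} {c} c≢a c≢b w =
  ≡-trans (pos-swapV a b c w) (cong (λ c → pos c w) (transpose-other c≢a c≢b))

swapV-involutive : ∀ a b w → swapV a b (swapV a b w) ≡ w
swapV-involutive a b []      = refl
swapV-involutive a b (y ∷ w) = cong₂ _∷_ (transpose-involutive a b y) (swapV-involutive a b w)

above⇒≢ : ∀ {x b t} → x ≤ b → All (b <_) t → All (x ≢_) t
above⇒≢ x≤b = All.map (λ b<y → <⇒≢ (≤-<-trans x≤b b<y))

pos-++ : ∀ {x} t r → All (x ≢_) t → pos x (t ++ r) ≡ length t + pos x r
pos-++ []      r []            = refl
pos-++ (y ∷ t) r (x≢y ∷ x∉t) rewrite ≢⇒≡ᵇ-false x≢y = cong suc (pos-++ t r x∉t)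

swapV-++ : ∀ {a b c} t r → a ≤ c → b ≤ c → All (c <_) t → swapV a b (t ++ r) ≡ t ++ swapV a b r
swapV-++ {a} {b} {c} t r a≤c b≤c c<t =
  ≡-trans (map-++ (transpose a b) t r) (cong (_++ swapV a b r) (map-id-local (All.map fixed c<t)))
  where
  fixed : ∀ {y} → c < y → transpose a b y ≡ y
  fixed c<y = transpose-other (>⇒≢ (≤-<-trans a≤c c<y)) (>⇒≢ (≤-<-trans b≤c c<y))

betweenᵇ-comm : ∀ m a b → betweenᵇ m a b ≡ betweenᵇ m b a
betweenᵇ-comm m a b = ∨-comm ((a <ᵇ m) ∧ (m <ᵇ b)) ((b <ᵇ m) ∧ (m <ᵇ a))

+-cancelˡ-betweenᵇ : ∀ l m a b → betweenᵇ (l + m) (l + a) (l + b) ≡ betweenᵇ m a b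
+-cancelˡ-betweenᵇ l m a b
  rewrite +-cancelˡ-<ᵇ l a m | +-cancelˡ-<ᵇ l m b | +-cancelˡ-<ᵇ l b m | +-cancelˡ-<ᵇ l m a = refl

betweenᵇ⇒ : ∀ {m a b} → betweenᵇ m a b ≡ true → (a < m × m < b) ⊎ (b < m × m < a)
betweenᵇ⇒ {m} {a} {b} e = Sum.map (ordered a m b) (ordered b m a) (Equivalence.to T-∨ (subst T (sym e) tt))
  where
  ordered : ∀ x y z → T ((x <ᵇ y) ∧ (y <ᵇ z)) → x < y × y < z
  ordered x y z h = Product.map (<ᵇ⇒< x y) (<ᵇ⇒< y z) (Equivalence.to T-∧ h)

betweenᵇ-exclusive : ∀ p q s → betweenᵇ p q s ≡ true → betweenᵇ s p q ≡ false
betweenᵇ-exclusive p q s e with betweenᵇ⇒ {p} {q} {s} e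
... | inj₁ (q<p , p<s)
  rewrite <ᵇ-true p<s | <ᵇ-false {s} {q} (<⇒≤ (<-trans q<p p<s))
        | <ᵇ-true (<-trans q<p p<s) | <ᵇ-false {s} {p} (<⇒≤ p<s) = refl
... | inj₂ (s<p , p<q)
  rewrite <ᵇ-false {p} {s} (<⇒≤ s<p) | <ᵇ-false {q} {s} (<⇒≤ (<-trans s<p p<q)) = refl

i-middleᵇ : ℕ → Word → Bool
i-middleᵇ i w = betweenᵇ (pos i w) (pos (i ∸ 1) w) (pos (suc i) w)

pred-middleᵇ : ℕ → Word → Bool
pred-middleᵇ i w = betweenᵇ (pos (i ∸ 1) w) (pos i w) (pos (suc i) w)

dW-by : Bool → Bool → ℕ → Word → Word
dW-by i-middle pred-middle i w =
  if i-middle then w else (if pred-middle then swapV i (suc i) w else swapV i (i ∸ 1) w)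

dW≡dW-by : ∀ i w {b₁ b₂} → i-middleᵇ i w ≡ b₁ → pred-middleᵇ i w ≡ b₂ → dW i w ≡ dW-by b₁ b₂ i w
dW≡dW-by i w = cong₂ (λ b₁ b₂ → dW-by b₁ b₂ i w)

dW-involutive : ∀ k w → dW (suc k) (dW (suc k) w) ≡ w
dW-involutive k w = by-cases (i-middleᵇ i w) (pred-middleᵇ i w) refl refl
  where
  i = suc k
  i≢1+i : i ≢ suc i
  i≢1+i = m≢1+n+m i {0}
  k≢i : k ≢ i
  k≢i = m≢1+n+m k {0}
  k≢1+i : k ≢ suc i
  k≢1+i = m≢1+n+m k {1}

  -- After the swap, the same swap is selected again: swapping i with i+1 keeps i-1 in the middle,
  -- and swapping i with i-1 exchanges the two tests.
  by-cases : ∀ b₁ b₂ → i-middleᵇ i w ≡ b₁ → pred-middleᵇ i w ≡ b₂ → dW i (dW i w) ≡ w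
  by-cases true _ i-mid pred-mid = ≡-trans (cong (dW i) (dW≡dW-by i w i-mid pred-mid)) (dW≡dW-by i w i-mid pred-mid)
  by-cases false true i-mid pred-mid =
    ≡-trans (cong (dW i) (dW≡dW-by i w i-mid pred-mid))
            (≡-trans (dW≡dW-by i _ i-mid′ pred-mid′) (swapV-involutive i (suc i) w))
    where
    i-mid′ : i-middleᵇ i (swapV i (suc i) w) ≡ false
    i-mid′ rewrite pos-swapV-left i (suc i) w | pos-swapV-right i≢1+i w | pos-swapV-other k≢i k≢1+i w
      = betweenᵇ-exclusive (pos k w) (pos i w) (pos (suc i) w) pred-mid
    pred-mid′ : pred-middleᵇ i (swapV i (suc i) w) ≡ true
    pred-mid′ rewrite pos-swapV-left i (suc i) w | pos-swapV-right i≢1+i w | pos-swapV-other k≢i k≢1+i w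
      = ≡-trans (betweenᵇ-comm (pos k w) (pos (suc i) w) (pos i w)) pred-mid
  by-cases false false i-mid pred-mid =
    ≡-trans (cong (dW i) (dW≡dW-by i w i-mid pred-mid))
            (≡-trans (dW≡dW-by i _ i-mid′ pred-mid′) (swapV-involutive i k w))
    where
    i-mid′ : i-middleᵇ i (swapV i k w) ≡ false
    i-mid′ rewrite pos-swapV-left i k w | pos-swapV-right (k≢i ∘ sym) w
                 | pos-swapV-other (i≢1+i ∘ sym) (k≢1+i ∘ sym) w = pred-mid
    pred-mid′ : pred-middleᵇ i (swapV i k w) ≡ false
    pred-mid′ rewrite pos-swapV-left i k w | pos-swapV-right (k≢i ∘ sym) w
                    | pos-swapV-other (i≢1+i ∘ sym) (k≢1+i ∘ sym) w = i-mid

dW-++ : ∀ {i} t r → All (suc i <_) t → dW i (t ++ r) ≡ t ++ dW i r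
dW-++ {i} t r i+1<t = begin
  dW i (t ++ r)                                        ≡⟨ dW≡dW-by i (t ++ r) i-middle-++ pred-middle-++ ⟩
  dW-by (i-middleᵇ i r) (pred-middleᵇ i r) i (t ++ r)  ≡⟨ dW-by-++ (i-middleᵇ i r) (pred-middleᵇ i r) ⟩
  t ++ dW i r                                          ∎
  where
  open ≡-Reasoning
  i-1≤i+1 : i ∸ 1 ≤ suc i
  i-1≤i+1 = ≤-trans (m∸n≤m i 1) (n≤1+n i)
  pos-shift : ∀ {x} → x ≤ suc i → pos x (t ++ r) ≡ length t + pos x r
  pos-shift x≤i+1 = pos-++ t r (above⇒≢ x≤i+1 i+1<t)
  i-middle-++ : i-middleᵇ i (t ++ r) ≡ i-middleᵇ i r
  i-middle-++ rewrite pos-shift (n≤1+n i) | pos-shift i-1≤i+1 | pos-shift ≤-refl = +-cancelˡ-betweenᵇ (length t) _ _ _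
  pred-middle-++ : pred-middleᵇ i (t ++ r) ≡ pred-middleᵇ i r
  pred-middle-++ rewrite pos-shift (n≤1+n i) | pos-shift i-1≤i+1 | pos-shift ≤-refl = +-cancelˡ-betweenᵇ (length t) _ _ _
  dW-by-++ : ∀ b₁ b₂ → dW-by b₁ b₂ i (t ++ r) ≡ t ++ dW-by b₁ b₂ i r
  dW-by-++ true  _     = refl
  dW-by-++ false true  = swapV-++ t r (n≤1+n i) ≤-refl i+1<t
  dW-by-++ false false = swapV-++ t r (n≤1+n i) i-1≤i+1 i+1<t

insert : Tableau → ℕ → Tableau
insert T x = insT x T

insRow-extend : ∀ {x r} → All (_< x) r → insRow x r ≡ (nothing , r ++ [ x ])
insRow-extend []            = refl
insRow-extend {x} (y<x ∷ r<x) rewrite <ᵇ-false {x} (<⇒≤ y<x) | insRow-extend r<x = refl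

insRow-bump : ∀ {x y r} s → All (_< x) r → x < y → insRow x (r ++ y ∷ s) ≡ (just y , r ++ x ∷ s)
insRow-bump s []              x<y rewrite <ᵇ-true x<y = refl
insRow-bump {x} s (z<x ∷ r<x) x<y rewrite <ᵇ-false {x} (<⇒≤ z<x) | insRow-bump s r<x x<y = refl

insT-extend : ∀ {x r} rs → All (_< x) r → insT x (r ∷ rs) ≡ (r ++ [ x ]) ∷ rs
insT-extend rs r<x rewrite insRow-extend r<x = refl

insT-bump : ∀ {x y r} s rs → All (_< x) r → x < y → insT x ((r ++ y ∷ s) ∷ rs) ≡ (r ++ x ∷ s) ∷ insT y rs
insT-bump s rs r<x x<y rewrite insRow-bump s r<x x<y = refl

EntriesBelow : ℕ → Tableau → Set
EntriesBelow b T = All (All (_< b)) T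

EntriesBelow-mono : ∀ {b c T} → b ≤ c → EntriesBelow b T → EntriesBelow c T
EntriesBelow-mono b≤c = All.map (All.map (λ x<b → <-≤-trans x<b b≤c))

insRow-below : ∀ {b x r} → x < b → All (_< b) r →
  Maybe.All (_< b) (proj₁ (insRow x r)) × All (_< b) (proj₂ (insRow x r))
insRow-below {r = []} x<b [] = Maybe.nothing , x<b ∷ []
insRow-below {x = x} {y ∷ r} x<b (y<b ∷ r<b) with x <ᵇ y
... | true  = Maybe.just y<b , x<b ∷ r<b
... | false with insRow x r | insRow-below x<b r<b
...   | _ , _ | bumped<b , r′<b = bumped<b , y<b ∷ r′<b

insT-below : ∀ {b x} T → x < b → EntriesBelow b T → EntriesBelow b (insT x T)
insT-below []                 x<b _             = (x<b ∷ []) ∷ []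
insT-below {x = x} (r ∷ rs) x<b (r<b ∷ rs<b) with insRow x r | insRow-below {r = r} x<b r<b
... | nothing , _ | _              , r′<b = r′<b ∷ rs<b
... | just _  , _ | Maybe.just y<b , r′<b = r′<b ∷ insT-below rs y<b rs<b

foldl-insert-below : ∀ {b} T w → All (_< b) w → EntriesBelow b T → EntriesBelow b (foldl insert T w)
foldl-insert-below T []      []          T<b = T<b
foldl-insert-below T (x ∷ w) (x<b ∷ w<b) T<b = foldl-insert-below (insert T x) w w<b (insT-below T x<b T<b)

foldl-insert-yxz≡yzx-∷ : ∀ {x y z} r rs → All (_< x) r → x < y → y < z →
  foldl insert (r ∷ rs) (y ∷ x ∷ z ∷ []) ≡ foldl insert (r ∷ rs) (y ∷ z ∷ x ∷ [])
foldl-insert-yxz≡yzx-∷ {x} {y} {z} r rs r<x x<y y<z = ≡-trans yxz (sym yzx)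
  where
  open ≡-Reasoning
  x<z : x < z
  x<z = <-trans x<y y<z
  r<y : All (_< y) r
  r<y = All.map (λ p → <-trans p x<y) r<x
  r<z : All (_< z) r
  r<z = All.map (λ p → <-trans p x<z) r<x
  yxz : foldl insert (r ∷ rs) (y ∷ x ∷ z ∷ []) ≡ (r ++ x ∷ z ∷ []) ∷ insT y rs
  yxz = begin
      insT z (insT x (insT y (r ∷ rs)))        ≡⟨ cong (insT z ∘ insT x) (insT-extend rs r<y) ⟩
      insT z (insT x ((r ++ [ y ]) ∷ rs))      ≡⟨ cong (insT z) (insT-bump [] rs r<x x<y) ⟩
      insT z ((r ++ [ x ]) ∷ insT y rs)        ≡⟨ insT-extend (insT y rs) (All.++⁺ r<z (x<z ∷ [])) ⟩
      ((r ++ [ x ]) ++ [ z ]) ∷ insT y rs      ≡⟨ cong (_∷ insT y rs) (++-assoc r [ x ] [ z ]) ⟩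
      (r ++ x ∷ z ∷ []) ∷ insT y rs            ∎
  yzx : foldl insert (r ∷ rs) (y ∷ z ∷ x ∷ []) ≡ (r ++ x ∷ z ∷ []) ∷ insT y rs
  yzx = begin
      insT x (insT z (insT y (r ∷ rs)))        ≡⟨ cong (insT x ∘ insT z) (insT-extend rs r<y) ⟩
      insT x (insT z ((r ++ [ y ]) ∷ rs))      ≡⟨ cong (insT x) (insT-extend rs (All.++⁺ r<z (y<z ∷ []))) ⟩
      insT x (((r ++ [ y ]) ++ [ z ]) ∷ rs)    ≡⟨ cong (λ row → insT x (row ∷ rs)) (++-assoc r [ y ] [ z ]) ⟩
      insT x ((r ++ y ∷ z ∷ []) ∷ rs)          ≡⟨ insT-bump [ z ] rs r<x x<y ⟩
      (r ++ x ∷ z ∷ []) ∷ insT y rs            ∎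

-- For T = [] this is the row case, since inserting y into [] or into [ [] ] gives the same tableau.
foldl-insert-yxz≡yzx : ∀ {x y z} T → x < y → y < z → EntriesBelow x T →
  foldl insert T (y ∷ x ∷ z ∷ []) ≡ foldl insert T (y ∷ z ∷ x ∷ [])
foldl-insert-yxz≡yzx []       x<y y<z _         = foldl-insert-yxz≡yzx-∷ [] [] [] x<y y<z
foldl-insert-yxz≡yzx (r ∷ rs) x<y y<z (r<x ∷ _) = foldl-insert-yxz≡yzx-∷ r rs r<x x<y y<z

KnuthEquiv-++ʳ : ∀ t t′ w → KnuthEquiv t t′ → KnuthEquiv (t ++ w) (t′ ++ w)
KnuthEquiv-++ʳ t t′ w t~t′ = begin
  P (t ++ w)            ≡⟨ foldl-++ insert [] t w ⟩
  foldl insert (P t) w  ≡⟨ cong (λ T → foldl insert T w) t~t′ ⟩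
  foldl insert (P t′) w ≡⟨ sym (foldl-++ insert [] t′ w) ⟩
  P (t′ ++ w)           ∎
  where open ≡-Reasoning

SYT-reading-↭ : ∀ {n λ′ T} → SYT n λ′ T → reading T ↭ interval 1 n
SYT-reading-↭ {n} {T = T} (_ , _ , _ , entries) = begin
  reading T          ↭⟨ concat⁺ (↭-reverse T) ⟩
  concat T           ↭⟨ entries ⟩
  map suc (upTo n)   ≡⟨ upTo≡interval n ⟩
  interval 1 n       ∎
  where open PermutationReasoning

tag : ℕ → ℕ → ℕ → Word
tag b zero    c       = []
tag b (suc K) zero    = 2 + b ∷ 1 + b ∷ 3 + b ∷ tag (3 + b) K zero
tag b (suc K) (suc c) = 2 + b ∷ 3 + b ∷ 1 + b ∷ tag (3 + b) K c

tag-above : ∀ b K c → All (b <_) (tag b K c)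
tag-above b zero    c = []
tag-above b (suc K) c = above c
  where
  b<1+b = n<1+n b
  b<2+b = m≤n+m (suc b) 1
  b<3+b = m≤n+m (suc b) 2
  above : ∀ c → All (b <_) (tag b (suc K) c)
  above zero    = b<2+b ∷ b<1+b ∷ b<3+b ∷ All.map (<-trans b<3+b) (tag-above (3 + b) K zero)
  above (suc c) = b<2+b ∷ b<3+b ∷ b<1+b ∷ All.map (<-trans b<3+b) (tag-above (3 + b) K c)

tag-length : ∀ b K c → length (tag b K c) ≡ K * 3
tag-length b zero    c       = refl
tag-length b (suc K) zero    = cong (3 +_) (tag-length (3 + b) K zero)
tag-length b (suc K) (suc c) = cong (3 +_) (tag-length (3 + b) K c)

tag-injective : ∀ b K {c c′} → c ≤ K → c′ ≤ K → tag b K c ≡ tag b K c′ → c ≡ c′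
tag-injective b zero    {zero}  {zero}   _       _         _ = refl
tag-injective b (suc K) {zero}  {zero}   _       _         _ = refl
tag-injective b (suc K) {zero}  {suc c′} _       _         e =
  contradiction (∷-injectiveˡ (∷-injectiveʳ e)) (m≢1+n+m (suc b) {1})
tag-injective b (suc K) {suc c} {zero}   _       _         e =
  contradiction (sym (∷-injectiveˡ (∷-injectiveʳ e))) (m≢1+n+m (suc b) {1})
tag-injective b (suc K) {suc c} {suc c′} (s≤s c≤K) (s≤s c′≤K) e =
  cong suc (tag-injective (3 + b) K c≤K c′≤K (∷-injectiveʳ (∷-injectiveʳ (∷-injectiveʳ e))))

tag-↭ : ∀ b K c → tag b K c ↭ interval (suc b) (K * 3)
tag-↭ b zero    c       = refl
tag-↭ b (suc K) zero    = trans (swap _ _ refl) (prep _ (prep _ (prep _ (tag-↭ (3 + b) K zero))))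
tag-↭ b (suc K) (suc c) =
  trans (prep _ (swap _ _ refl)) (trans (swap _ _ refl) (prep _ (prep _ (prep _ (tag-↭ (3 + b) K c)))))

foldl-insert-tag : ∀ b K c T → EntriesBelow (suc b) T → foldl insert T (tag b K c) ≡ foldl insert T (tag b K 0)
foldl-insert-tag b zero    c       T T<b+1 = refl
foldl-insert-tag b (suc K) zero    T T<b+1 = refl
foldl-insert-tag b (suc K) (suc c) T T<b+1 = begin
    foldl insert (foldl insert T yzx) (tag (3 + b) K c)
      ≡⟨ cong (λ U → foldl insert U (tag (3 + b) K c)) (sym yxz≡yzx) ⟩
    foldl insert (foldl insert T yxz) (tag (3 + b) K c)
      ≡⟨ foldl-insert-tag (3 + b) K c _ yxz-below ⟩
    foldl insert (foldl insert T yxz) (tag (3 + b) K 0)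
      ∎
  where
  open ≡-Reasoning
  yxz yzx : Word
  yxz = 2 + b ∷ 1 + b ∷ 3 + b ∷ []
  yzx = 2 + b ∷ 3 + b ∷ 1 + b ∷ []
  yxz≡yzx : foldl insert T yxz ≡ foldl insert T yzx
  yxz≡yzx = foldl-insert-yxz≡yzx T (n<1+n (suc b)) (n<1+n (2 + b)) T<b+1
  yxz-below : EntriesBelow (4 + b) (foldl insert T yxz)
  yxz-below = foldl-insert-below T yxz (m≤n+m (3 + b) 1 ∷ m≤n+m (2 + b) 2 ∷ n<1+n (3 + b) ∷ [])
                                      (EntriesBelow-mono (m≤n+m (suc b) 3) T<b+1)

tag-knuth : ∀ b K c → KnuthEquiv (tag b K c) (tag b K 0)
tag-knuth b K c = foldl-insert-tag b K c [] []

<∸1⇒2+≤ : ∀ {j n} → j < n ∸ 1 → 2 + j ≤ n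
<∸1⇒2+≤ {n = suc n} j<n = s≤s j<n

<⇒≤∸1 : ∀ {i n} → i < n → i ≤ n ∸ 1
<⇒≤∸1 (s≤s i≤n) = i≤n

truncVec-tabulate : ∀ {A : Set} {m k} (p : m ≤ k) (f g : ℕ → A) → (∀ j → j < m → f j ≡ g j) →
  truncVec p (tabulate {n = k} (f ∘ toℕ)) ≡ tabulate {n = m} (g ∘ toℕ)
truncVec-tabulate z≤n     f g f≗g = refl
truncVec-tabulate (s≤s p) f g f≗g =
  cong₂ _∷ᵛ_ (f≗g 0 (s≤s z≤n)) (truncVec-tabulate p (f ∘ suc) (g ∘ suc) (λ j j<m → f≗g (suc j) (s≤s j<m)))

at-truncVec : ∀ {m k} (p : m ≤ k) (xs : Vec Sign k) j → j ≤ m → at (truncVec p xs) j ≡ at xs j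
at-truncVec z≤n     []ᵛ       zero          _         = refl
at-truncVec z≤n     (x ∷ᵛ xs) zero          _         = refl
at-truncVec (s≤s p) (x ∷ᵛ xs) zero          _         = refl
at-truncVec (s≤s p) (x ∷ᵛ xs) (suc zero)    _         = refl
at-truncVec (s≤s p) (x ∷ᵛ xs) (suc (suc j)) (s≤s j≤m) = at-truncVec p xs (suc j) j≤m

sigW-++ : ∀ {n} N t r (p : n ∸ 1 ≤ N ∸ 1) → All (n <_) t → truncVec p (sigW N (t ++ r)) ≡ sigW n r
sigW-++ {n} N t r p n<t = truncVec-tabulate p (sign (t ++ r)) (sign r) agree
  where
  sign : Word → ℕ → Sign
  sign w j = if pos (suc j) w <ᵇ pos (suc (suc j)) w then plus else minus
  pos-shift : ∀ {x} → x ≤ n → pos x (t ++ r) ≡ length t + pos x r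
  pos-shift x≤n = pos-++ t r (above⇒≢ x≤n n<t)
  agree : ∀ j → j < n ∸ 1 → sign (t ++ r) j ≡ sign r j
  agree j j<n-1 = cong (λ before → if before then plus else minus)
    (≡-trans (cong₂ _<ᵇ_ (pos-shift (≤-trans (n≤1+n (suc j)) 2+j≤n)) (pos-shift 2+j≤n))
             (+-cancelˡ-<ᵇ (length t) _ _))
    where
    2+j≤n = <∸1⇒2+≤ j<n-1

MatchedAt : ∀ {n N} (G : SCG n N) → ℕ → V G → Set → Set
MatchedAt G i v admits =
  (admits → Σ (V G) λ u → E G i v u × (∀ w → E G i v w → w ≡ u)) × (¬ admits → ∀ u → ¬ E G i v u)

Axiom1-restrict : ∀ {n N} (H : SCG n N) → Axiom1 (restrict H) → Axiom1 H
Axiom1-restrict {n} H ax i 1<i i<n v = subst (MatchedAt H i v) admits≡ (ax i 1<i i<n v)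
  where
  p = ∸-monoˡ-≤ 1 (n≤N H)
  admits≡ : Admits (restrict H) i v ≡ Admits H i v
  admits≡ = cong₂ (λ s s′ → s ≡ neg s′)
    (at-truncVec p (σ H v) (i ∸ 1) (∸-monoˡ-≤ 1 (<⇒≤ i<n))) (at-truncVec p (σ H v) i (<⇒≤∸1 i<n))

Axiom1-iso : ∀ {n N} {G G′ : SCG n N} → Iso G G′ → Axiom1 G → Axiom1 G′
Axiom1-iso {G = G} {G′} G≅G′ ax i 1<i i<n v = matched , unmatched
  where
  open Iso G≅G′
  open Morphism to   renaming (map-V to f; map-E to f-E)
  open Morphism from renaming (map-V to g; map-E to g-E; map-σ to g-σ)
  admits⇒ : Admits G′ i v → Admits G i (g v)
  admits⇒ = subst (λ s → at s (i ∸ 1) ≡ neg (at s i)) (sym (g-σ v))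
  admits⇐ : Admits G i (g v) → Admits G′ i v
  admits⇐ = subst (λ s → at s (i ∸ 1) ≡ neg (at s i)) (g-σ v)
  matched : Admits G′ i v → Σ (V G′) λ u → E G′ i v u × (∀ w → E G′ i v w → w ≡ u)
  matched a with proj₁ (ax i 1<i i<n (g v)) (admits⇒ a)
  ... | u , e , unique =
    f u , subst (λ x → E G′ i x (f u)) (to∘from v) (f-E e) ,
    λ w e′ → ≡-trans (sym (to∘from w)) (cong f (unique (g w) (g-E e′)))
  unmatched : ¬ Admits G′ i v → ∀ u → ¬ E G′ i v u
  unmatched ¬a u e = proj₂ (ax i 1<i i<n (g v)) (¬a ∘ admits⇐) (g u) (g-E e)

extendSignatures : ∀ {n N} (G : SCG n n) → n ≤ N → (V G → Vec Sign (N ∸ 1)) → SCG n N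
extendSignatures G n≤N τ = record
  { V = V G ; σ = τ ; E = E G ; n≤N = n≤N ; E-col = E-col G ; E-sym = E-sym G ; E-irr = E-irr G }

extendSignatures-iso : ∀ {n N} (G : SCG n n) (n≤N : n ≤ N) τ →
  (∀ v → σ (restrict (extendSignatures G n≤N τ)) v ≡ σ G v) → Iso G (restrict (extendSignatures G n≤N τ))
extendSignatures-iso G n≤N τ σ-agrees = record
  { to      = record { map-V = λ v → v ; map-E = λ e → e ; map-σ = σ-agrees }
  ; from    = record { map-V = λ v → v ; map-E = λ e → e ; map-σ = sym ∘ σ-agrees }
  ; from∘to = λ _ → refl
  ; to∘from = λ _ → refl
  }

Gλ-edge-reading : ∀ {n λ′ k} (S T : V (Gλ n λ′)) → E (Gλ n λ′) (suc k) S T →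
  reading (proj₁ T) ≡ dW (suc k) (reading (proj₁ S))
Gλ-edge-reading S T (_ , inj₁ (T≡dS , _)) = T≡dS
Gλ-edge-reading {k = k} S T (_ , inj₂ (S≡dT , _)) = begin
  reading (proj₁ T)                                ≡⟨ sym (dW-involutive k (reading (proj₁ T))) ⟩
  dW (suc k) (dW (suc k) (reading (proj₁ T)))      ≡⟨ cong (dW (suc k)) (sym S≡dT) ⟩
  dW (suc k) (reading (proj₁ S))                   ∎
  where open ≡-Reasoning

module Embedding {n} (G : SCG n n) (vertices : List (V G)) (complete : ∀ v → v ∈ vertices)
                 {λ′} (φ : Morphism G (Gλ n λ′)) where

  open Morphism φ

  K : ℕ
  K = length vertices

  code : V G → ℕ
  code v = toℕ (index (complete v))

  code≤K : ∀ v → code v ≤ K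
  code≤K v = <⇒≤ (toℕ<n (index (complete v)))

  tagOf readingOf embed : V G → Word
  tagOf v     = tag n K (code v)
  readingOf v = reading (proj₁ (map-V v))
  embed v     = tagOf v ++ readingOf v

  N : ℕ
  N = n + K * 3

  n≤n+3K : n ≤ N
  n≤n+3K = m≤m+n n (K * 3)

  H : SCG n N
  H = extendSignatures G n≤n+3K (λ v → sigW N (embed v))

  restrict-σ : ∀ v → σ (restrict H) v ≡ σ G v
  restrict-σ v = ≡-trans (sigW-++ N (tagOf v) (readingOf v) _ (tag-above n K (code v))) (map-σ v)

  G≅H : Iso G (restrict H)
  G≅H = extendSignatures-iso G n≤n+3K (λ v → sigW N (embed v)) restrict-σ

  embed-injective : ∀ u v → embed u ≡ embed v → u ≡ v
  embed-injective u v e = begin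
    u                                     ≡⟨ lookup-index (complete u) ⟩
    lookup vertices (index (complete u))  ≡⟨ cong (lookup vertices) (toℕ-injective codes≡) ⟩
    lookup vertices (index (complete v))  ≡⟨ sym (lookup-index (complete v)) ⟩
    v                                     ∎
    where
    open ≡-Reasoning
    tags≡ : tagOf u ≡ tagOf v
    tags≡ = ++-injectiveˡ (≡-trans (tag-length n K (code u)) (sym (tag-length n K (code v)))) e
    codes≡ : code u ≡ code v
    codes≡ = tag-injective n K (code≤K u) (code≤K v) tags≡

  embed-isPerm : ∀ v → IsPerm N (embed v)
  embed-isPerm v = begin
    tagOf v ++ readingOf v                    ↭⟨ ++-comm (tagOf v) (readingOf v) ⟩
    readingOf v ++ tagOf v                    ↭⟨ ++⁺ (SYT-reading-↭ (proj₂ (map-V v))) (tag-↭ n K (code v)) ⟩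
    interval 1 n ++ interval (suc n) (K * 3)  ≡⟨ sym (interval-+ 1 n (K * 3)) ⟩
    interval 1 N                              ≡⟨ sym (upTo≡interval N) ⟩
    map suc (upTo N)                          ∎
    where open PermutationReasoning

  embed-knuth : ∀ i → 1 < i → i < n → ∀ v u → E G i v u → KnuthEquiv (embed u) (dW i (embed v))
  embed-knuth i (s≤s (s≤s z≤n)) i<n v u e = begin
    P (tagOf u ++ readingOf u)         ≡⟨ KnuthEquiv-++ʳ (tagOf u) (tagOf v) (readingOf u) tags~ ⟩
    P (tagOf v ++ readingOf u)         ≡⟨ cong (λ r → P (tagOf v ++ r)) (Gλ-edge-reading (map-V v) (map-V u) (map-E e)) ⟩
    P (tagOf v ++ dW i (readingOf v))  ≡⟨ cong P (sym (dW-++ (tagOf v) (readingOf v) tag>i+1)) ⟩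
    P (dW i (embed v))                 ∎
    where
    open ≡-Reasoning
    tags~ : KnuthEquiv (tagOf u) (tagOf v)
    tags~ = ≡-trans (tag-knuth n K (code u)) (sym (tag-knuth n K (code v)))
    tag>i+1 : All (suc i <_) (tagOf v)
    tag>i+1 = All.map (≤-<-trans i<n) (tag-above n K (code v))

theorem3p14 : (n : ℕ) (G : SCG n n) → Finite G → V G → Axiom1 G →
    (λ′ : List ℕ) → Partition n λ′ → Morphism G (Gλ n λ′) →
    Σ ℕ λ N → Σ (SCG n N) λ H →
      Finite H × Axiom1 H ×
      (Σ (V H → Word) λ ι →
        (∀ u v → ι u ≡ ι v → u ≡ v) ×
        (∀ v → IsPerm N (ι v)) ×
        (∀ v → σ H v ≡ sigW N (ι v)) ×
        (∀ i → 1 < i → i < n → ∀ v u → E H i v u → KnuthEquiv (ι u) (dW i (ι v)))) ×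
      Iso G (restrict H)
theorem3p14 n G (vertices , complete) _ ax _ _ φ =
  N , H , (vertices , complete) , Axiom1-restrict H (Axiom1-iso G≅H ax) ,
  (embed , embed-injective , embed-isPerm , (λ _ → refl) , embed-knuth) , G≅H
  where open Embedding G vertices complete φ
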